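{- Let $(\Gamma,X,\mathcal B)\in\mathcal G$ with $b\ge 3$ and $r=2$. Let $$\Delta=\{(C,B(\mathfrak v),B(\mathfrak u),D): (\mathfrak v,\mathfrak u)\in Arc(\Gamma),\ \mathfrak v\in B(\mathfrak v)\in\mathcal B,\ \mathfrak u\in B(\mathfrak u)\in\mathcal B,\ C\in\Gamma_{\mathcal B}(\mathfrak v),\ D\in\Gamma_{\mathcal B}(\mathfrak u),\ C\ne B(\mathfrak u),\ D\ne B(\mathfrak v)\}.$$ Suppose that, for a given $B_0\in\mathcal B$, $\Gamma(D)\cap B_0\cap\Gamma(C)\ne\emptyset$ for every $2$-path $[D,B_0,C]$ of $\Gamma_{\mathcal B}$ with middle vertex $B_0$. Then $\Gamma_{\mathcal B}$ is $(X,2)$-arc-transitive, $\lambda:=|\Gamma(D)\cap B\cap\Gamma(C)|$ is independent of the choice of the $2$-path $[D,B,C]$ of $\Gamma_{\mathcal B}$, $\Delta$ is a self-paired $X$-orbit on $Arc_3(\Gamma_{\mathcal B})$, and either (a) $\lambda=1$ and $\Gamma\cong\gimel(\Gamma_{\mathcal B},\Delta)$; or (b) $\lambda\ge2$ and $\mathcal Q:=\{\Gamma(D)\cap B\cap\Gamma(C): [D,B,C]\in Path_2(\Gamma_{\mathcal B})\}$ is a second nontrivial $X$-invariant partition of $V(\Gamma)$ which is a proper refinement of $\mathcal B$, and $\Gamma_{\mathcal Q}\cong\gimel(\Gamma_{\mathcal B},\Delta)$.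
   Context: Graphs are finite, simple, undirected; $\Gamma(\mathfrak u)$ denotes a neighbourhood. An $s$-arc is a sequence $(\alpha_0,\dots,\alpha_s)$ of vertices with consecutive ones adjacent and $\alpha_{i-1}\ne\alpha_{i+1}$; $Arc_s$ is the set of $s$-arcs, $Arc=Arc_1$; an $s$-arc with distinct entries identified with its reverse is an $s$-path $[\alpha_0,\dots,\alpha_s]$, and $Path_s$ is the set of $s$-paths. A set of $3$-arcs is self-paired if closed under reversal. A graph is $X$-symmetric if $X$ acts preserving adjacency, transitively on vertices and on arcs; $(X,2)$-arc-transitive if moreover transitive on $2$-arcs. For an $X$-invariant partition $\mathcal B$ of $V(\Gamma)$, $\Gamma_{\mathcal B}$ is the quotient graph on $\mathcal B$ ($B\sim C$ iff some vertex of $B$ is adjacent to some vertex of $C$), $\Gamma(C)=\bigcup_{\mathfrak u\in C}\Gamma(\mathfrak u)$, $\Gamma_{\mathcal B}(\mathfrak v)=\{C\in\mathcal B:\mathfrak v\in\Gamma(C)\}$; $v=|B|$, $k=|\Gamma(C)\cap B|$ for adjacent $B,C$, $r=|\Gamma_{\mathcal B}(\mathfrak v)|$, $b=val(\Gamma_{\mathcal B})$. $\Gamma$ is a multicover of $\Gamma_{\mathcal B}$ if $k=v$. $\mathcal G$ is the set of triples $(\Gamma,X,\mathcal B)$ with $\Gamma$ finite $X$-symmetric, $\mathcal B$ an $X$-invariant partition with $1<|B|<|V(\Gamma)|$, $val(\Gamma_{\mathcal B})\ge2$ and $\Gamma$ not a multicover of $\Gamma_{\mathcal B}$. For a graph $\Sigma$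 and a self-paired $\Delta\subseteq Arc_3(\Sigma)$, $\gimel(\Sigma,\Delta)$ is the graph with vertex set $Path_2(\Sigma)$ and edges $\{[\alpha_0,\alpha_1,\alpha_2],[\alpha_1,\alpha_2,\alpha_3]\}$ for $(\alpha_0,\alpha_1,\alpha_2,\alpha_3)\in\Delta$. -}

module Defs where

open import Level using (Level; _⊔_) renaming (zero to lzero)
open import Data.Nat using (ℕ; zero; suc; _+_; _<_; _≤_)
open import Data.Fin using (Fin; toℕ) renaming (zero to fzero; suc to fsuc)
open import Data.Fin.Properties using (_≟_)
open import Data.Bool using (Bool; true; false; _∧_; _∨_; T; if_then_else_)
open import Data.Product using (Σ; ∃; _×_; _,_)
open import Data.Sum using (_⊎_)
open import Relation.Nullary using (¬_; ⌊_⌋)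
open import Relation.Binary.PropositionalEquality using (_≡_; _≢_)
open import Algebra.Bundles using (Group)

anyF : ∀ {n} → (Fin n → Bool) → Bool
anyF {zero}  P = false
anyF {suc n} P = P fzero ∨ anyF (λ i → P (fsuc i))

count : ∀ {n} → (Fin n → Bool) → ℕ
count {zero}  P = 0
count {suc n} P = (if P fzero then 1 else 0) + count (λ i → P (fsuc i))

_==_ : ∀ {n} → Fin n → Fin n → Bool
a == b = ⌊ a ≟ b ⌋

record Graph (n : ℕ) : Set where
  field
    adj    : Fin n → Fin n → Bool
    sym    : ∀ u v → adj u v ≡ adj v u
    irrefl : ∀ v → adj v v ≡ false

record Action {c ℓ : Level} (X : Group c ℓ) (n : ℕ) : Set (c ⊔ ℓ) where
  open Group X
  field
    act      : Carrier → Fin n → Fin n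
    act-ε    : ∀ v → act ε v ≡ v
    act-∙    : ∀ x y v → act (x ∙ y) v ≡ act x (act y v)
    act-cong : ∀ {x y} → x ≈ y → ∀ v → act x v ≡ act y v

Iso : {V W : Set} → (V → V → Set) → (W → W → Set) → Set
Iso {V} {W} E F =
  Σ (V → W) λ f → Σ (W → V) λ g →
    (∀ v → g (f v) ≡ v) × (∀ w → f (g w) ≡ w) ×
    (∀ u v → (E u v → F (f u) (f v)) × (F (f u) (f v) → E u v))

-- Quotient notions for a partition of Fin n given by a block map
-- f : Fin n → Fin m (the parts are the nonempty fibres of f).

module Quot {n : ℕ} (adj : Fin n → Fin n → Bool) {m : ℕ} (f : Fin n → Fin m) where

  size : Fin m → ℕ
  size a = count (λ u → f u == a)

  qadj : Fin m → Fin m → Bool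
  qadj a b = (if a == b then false else true) ∧
             anyF (λ u → anyF (λ w → (f u == a) ∧ ((f w == b) ∧ adj u w)))

  inN : Fin n → Fin m → Bool
  inN u C = anyF (λ w → (f w == C) ∧ adj u w)

  kSize : Fin m → Fin m → ℕ
  kSize B C = count (λ u → (f u == B) ∧ inN u C)

  rSize : Fin n → ℕ
  rSize v = count (λ C → inN v C)

  valQ : Fin m → ℕ
  valQ B = count (λ C → qadj B C)

  lamSize : Fin m → Fin m → Fin m → ℕ
  lamSize D B C = count (λ u → inN u D ∧ ((f u == B) ∧ inN u C))

  IsPath2 : Fin m → Fin m → Fin m → Set
  IsPath2 D B C = T (qadj D B) × T (qadj B C) × D ≢ C

module Act {c ℓ : Level} {X : Group c ℓ} {n : ℕ} (A : Action X n) where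
  open Group X using (Carrier)
  open Action A

  Symmetric : (adj : Fin n → Fin n → Bool) → Set c
  Symmetric adj =
    (∀ x u v → adj (act x u) (act x v) ≡ adj u v) ×
    (∀ u v → ∃ λ x → act x u ≡ v) ×
    (∀ u v u' v' → T (adj u v) → T (adj u' v') →
       ∃ λ x → act x u ≡ u' × act x v ≡ v')

  Invariant : ∀ {m} → (Fin n → Fin m) → Set c
  Invariant f = ∀ x u v → f u ≡ f v → f (act x u) ≡ f (act x v)

  MapsPart : ∀ {m} → (Fin n → Fin m) → Carrier → Fin m → Fin m → Set
  MapsPart f x a b = ∀ u → f u ≡ a → f (act x u) ≡ b

  TwoArcTransQ : ∀ {m} → (Fin n → Fin n → Bool) → (Fin n → Fin m) → Set c
  TwoArcTransQ adj f =
    (∀ a b → ∃ λ x → MapsPart f x a b) ×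
    (∀ a0 a1 c0 c1 → T (qadj a0 a1) → T (qadj c0 c1) →
       ∃ λ x → MapsPart f x a0 c0 × MapsPart f x a1 c1) ×
    (∀ a0 a1 a2 c0 c1 c2 →
       T (qadj a0 a1) → T (qadj a1 a2) → a0 ≢ a2 →
       T (qadj c0 c1) → T (qadj c1 c2) → c0 ≢ c2 →
       ∃ λ x → MapsPart f x a0 c0 × MapsPart f x a1 c1 × MapsPart f x a2 c2)
    where open Quot adj f

  IsArc3 : ∀ {m} → (Fin n → Fin n → Bool) → (Fin n → Fin m) →
           Fin m → Fin m → Fin m → Fin m → Set
  IsArc3 adj f a0 a1 a2 a3 =
    T (qadj a0 a1) × T (qadj a1 a2) × T (qadj a2 a3) × a0 ≢ a2 × a1 ≢ a3
    where open Quot adj f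

  SelfPairedOrbit3 : ∀ {m} → (Fin n → Fin n → Bool) → (Fin n → Fin m) →
                     (Fin m → Fin m → Fin m → Fin m → Set) → Set c
  SelfPairedOrbit3 {m} adj f Δ =
    (∃ λ a0 → ∃ λ a1 → ∃ λ a2 → ∃ λ a3 → Δ a0 a1 a2 a3) ×
    (∀ a0 a1 a2 a3 → Δ a0 a1 a2 a3 → IsArc3 adj f a0 a1 a2 a3) ×
    (∀ a0 a1 a2 a3 (x : Carrier) (c0 c1 c2 c3 : Fin m) → Δ a0 a1 a2 a3 →
       MapsPart f x a0 c0 → MapsPart f x a1 c1 →
       MapsPart f x a2 c2 → MapsPart f x a3 c3 → Δ c0 c1 c2 c3) ×
    (∀ a0 a1 a2 a3 c0 c1 c2 c3 → Δ a0 a1 a2 a3 → Δ c0 c1 c2 c3 →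
       ∃ λ x → MapsPart f x a0 c0 × MapsPart f x a1 c1 ×
               MapsPart f x a2 c2 × MapsPart f x a3 c3) ×
    (∀ a0 a1 a2 a3 → Δ a0 a1 a2 a3 → Δ a3 a2 a1 a0)

-- The graph ℷ(Σ,Δ).  A 2-path [a0,a1,a2] (identified with its reverse)
-- is represented canonically by the triple with toℕ a0 < toℕ a2.

module Gimel {m : ℕ} (adjΣ : Fin m → Fin m → Bool)
             (Δ : Fin m → Fin m → Fin m → Fin m → Set) where

  Path2 : Set
  Path2 = Σ (Fin m × Fin m × Fin m) λ { (a0 , a1 , a2) →
            T (adjΣ a0 a1) × T (adjΣ a1 a2) × toℕ a0 < toℕ a2 }

  Rep : Path2 → Fin m → Fin m → Fin m → Set
  Rep ((b0 , b1 , b2) , _) a0 a1 a2 =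
    (b0 ≡ a0 × b1 ≡ a1 × b2 ≡ a2) ⊎ (b0 ≡ a2 × b1 ≡ a1 × b2 ≡ a0)

  gadj : Path2 → Path2 → Set
  gadj p q = ∃ λ a0 → ∃ λ a1 → ∃ λ a2 → ∃ λ a3 → Δ a0 a1 a2 a3 ×
    ((Rep p a0 a1 a2 × Rep q a1 a2 a3) ⊎ (Rep q a0 a1 a2 × Rep p a1 a2 a3))

module DeltaDef {n : ℕ} (adj : Fin n → Fin n → Bool) {m : ℕ} (f : Fin n → Fin m) where
  open Quot adj f

  Δ : Fin m → Fin m → Fin m → Fin m → Set
  Δ C B1 B2 D = ∃ λ v → ∃ λ u → T (adj v u) × f v ≡ B1 × f u ≡ B2 ×
                T (inN v C) × T (inN u D) × C ≢ B2 × D ≢ B1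

module Submission where

-- Blocks are independent sets, and as r = 2 every vertex u sees
-- exactly two blocks L(u), R(u); so u determines the 2-path
-- pathOf u = [L(u), B(u), R(u)] of Γ_B, and the fibre of pathOf over a
-- 2-path [D,B,C] is precisely Γ(D) ∩ B ∩ Γ(C).  Transitivity of X on
-- blocks spreads the hypothesis at B₀ to all 2-paths, so pathOf is onto;
-- mapping one such vertex to another, and swapping its two blocks by an
-- arc-stabiliser if necessary, gives 2-arc-transitivity, hence a constant λ.
-- Arcs of Γ correspond to elements of Δ and to edges of ℷ(Γ_B,Δ).  If λ = 1
-- pathOf is a bijection, otherwise its fibres form the partition 𝒬.

open import Defs
open import Level using (Level)
open import Data.Nat using (ℕ; zero; suc; _+_; _*_; _<_; _≤_; _<ᵇ_; z≤n; s≤s; s≤s⁻¹)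
open import Data.Nat.Properties using (+-suc; ≤-antisym; ≤-refl; ≤-trans; m≤n⇒m<n∨m≡n; <-irrelevant; <-irrefl; <-asym; <-cmp; <ᵇ⇒<; <⇒<ᵇ)
open import Data.Fin using (Fin; toℕ) renaming (zero to fzero; suc to fsuc)
open import Data.Fin.Properties using (_≟_; 0≢1+n; suc-injective; toℕ-injective; *↔×; +↔⊎; 0↔⊥; 1↔⊤)
open import Data.Bool using (Bool; true; false; T; _∧_; not; if_then_else_)
open import Data.Bool.Properties using (T-∧; T-∨; T-irrelevant)
import Data.Bool.Properties as Bool
open import Data.Unit using (tt)
open import Data.Empty using (⊥-elim)
open import Data.Product using (Σ; ∃; _×_; _,_; proj₁; proj₂)
open import Data.Sum using (_⊎_; inj₁; inj₂)
open import Function using (_∘_; case_of_)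
open import Function.Bundles using (Equivalence; Inverse; _↔_; mk↔ₛ′)
open import Function.Properties.Inverse using (↔-refl; ↔-sym; ↔-trans)
open import Data.Sum.Function.Propositional using (_⊎-↔_)
open import Data.Product.Function.NonDependent.Propositional using (_×-↔_)
open import Data.Product.Function.Dependent.Propositional using (Σ-↔)
open import Relation.Nullary using (¬_; Dec; yes; no; isYes)
open import Algebra.Bundles using (Group)
open import Relation.Nullary.Decidable using (toWitness; fromWitness)
open import Relation.Binary using (tri<; tri≈; tri>)
open import Relation.Binary.PropositionalEquality

∧-intro : ∀ {a b} → T a → T b → T (a ∧ b)
∧-intro p q = Equivalence.from T-∧ (p , q)

∧-elim : ∀ {a b} → T (a ∧ b) → T a × T b
∧-elim = Equivalence.to T-∧

==⇒≡ : ∀ {n} {a b : Fin n} → T (a == b) → a ≡ b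
==⇒≡ = toWitness

≡⇒== : ∀ {n} {a b : Fin n} → a ≡ b → T (a == b)
≡⇒== = fromWitness

∧-differs : ∀ {a b} → (a ∧ b) ≢ a → T a × ¬ T b
∧-differs {true} {true} d = ⊥-elim (d refl)
∧-differs {true} {false} d = tt , (λ ())
∧-differs {false} d = ⊥-elim (d refl)

anyF-intro : ∀ {n} (P : Fin n → Bool) i → T (P i) → T (anyF P)
anyF-intro P fzero p = Equivalence.from T-∨ (inj₁ p)
anyF-intro P (fsuc i) p = Equivalence.from T-∨ (inj₂ (anyF-intro (P ∘ fsuc) i p))

anyF-elim : ∀ {n} (P : Fin n → Bool) → T (anyF P) → ∃ λ i → T (P i)
anyF-elim {suc n} P t with Equivalence.to (T-∨ {P fzero}) t
... | inj₁ p = fzero , p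
... | inj₂ q with anyF-elim (P ∘ fsuc) q
...   | i , p = fsuc i , p

count-cong : ∀ {n} {P Q : Fin n → Bool} → (∀ i → P i ≡ Q i) → count P ≡ count Q
count-cong {zero} e = refl
count-cong {suc n} e = cong₂ (λ b r → (if b then 1 else 0) + r) (e fzero) (count-cong (e ∘ fsuc))

==-suc : ∀ {n} (j k : Fin n) → (fsuc j == fsuc k) ≡ (j == k)
==-suc j k with j ≟ k
... | yes _ = refl
... | no _ = refl

≢⇒not== : ∀ {n} {a b : Fin n} → a ≢ b → T (not (a == b))
≢⇒not== {a = a} {b} a≢b with a ≟ b
... | yes a≡b = a≢b a≡b
... | no _ = tt

count-without : ∀ {n} (Q : Fin n → Bool) k → T (Q k) →
  count Q ≡ suc (count (λ j → Q j ∧ not (j == k)))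
count-without Q fzero q with Q fzero
... | true = cong suc (count-cong (λ j → sym (Bool.∧-identityʳ (Q (fsuc j)))))
count-without Q (fsuc k) q = begin
  (if Q fzero then 1 else 0) + count (Q ∘ fsuc)
    ≡⟨ cong₂ _+_ (cong (λ b → if b then 1 else 0) (sym (Bool.∧-identityʳ (Q fzero))))
                 (count-without (Q ∘ fsuc) k q) ⟩
  (if Q fzero ∧ true then 1 else 0) + suc (count (λ j → Q (fsuc j) ∧ not (j == k)))
    ≡⟨ +-suc _ _ ⟩
  suc ((if Q fzero ∧ true then 1 else 0) + count (λ j → Q (fsuc j) ∧ not (j == k)))
    ≡⟨ cong (λ r → suc ((if Q fzero ∧ true then 1 else 0) + r))
            (count-cong (λ j → cong (λ b → Q (fsuc j) ∧ not b) (sym (==-suc j k)))) ⟩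
  suc (count (λ j → Q j ∧ not (j == fsuc k)))
    ∎
  where open ≡-Reasoning

InjectiveOn : ∀ {n n'} → (Fin n → Bool) → (Fin n → Fin n') → Set
InjectiveOn P g = ∀ i j → T (P i) → T (P j) → g i ≡ g j → i ≡ j

injectiveOn-suc : ∀ {n n'} {P : Fin (suc n) → Bool} {g : Fin (suc n) → Fin n'} →
  InjectiveOn P g → InjectiveOn (P ∘ fsuc) (g ∘ fsuc)
injectiveOn-suc inj i j p q e = suc-injective (inj (fsuc i) (fsuc j) p q e)

count-mono : ∀ {n n'} (P : Fin n → Bool) (Q : Fin n' → Bool) (g : Fin n → Fin n') →
  (∀ i → T (P i) → T (Q (g i))) → InjectiveOn P g → count P ≤ count Q
count-mono {zero} P Q g into inj = z≤n
count-mono {suc n} P Q g into inj with P fzero in P0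
... | false = count-mono (P ∘ fsuc) Q (g ∘ fsuc) (into ∘ fsuc) (injectiveOn-suc inj)
... | true rewrite count-without Q (g fzero) (into fzero (subst T (sym P0) tt)) =
  s≤s (count-mono (P ∘ fsuc) (λ j → Q j ∧ not (j == g fzero)) (g ∘ fsuc) into-rest (injectiveOn-suc inj))
  where
  into-rest : ∀ i → T (P (fsuc i)) → T (Q (g (fsuc i)) ∧ not (g (fsuc i) == g fzero))
  into-rest i p = ∧-intro (into (fsuc i) p)
    (≢⇒not== (λ e → 0≢1+n (sym (inj (fsuc i) fzero p (subst T (sym P0) tt) e))))

count-bijection : ∀ {n} (P P' : Fin n → Bool) (π σ : Fin n → Fin n) →
  (∀ u → σ (π u) ≡ u) → (∀ u → π (σ u) ≡ u) →
  (∀ u → T (P u) → T (P' (π u))) → (∀ u → T (P' u) → T (P (σ u))) →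
  count P ≡ count P'
count-bijection P P' π σ σπ πσ into into' = ≤-antisym
  (count-mono P P' π into (λ i j _ _ q → trans (sym (σπ i)) (trans (cong σ q) (σπ j))))
  (count-mono P' P σ into' (λ i j _ _ q → trans (sym (πσ i)) (trans (cong π q) (πσ j))))

count≥1 : ∀ {n} (P : Fin n → Bool) i → T (P i) → 1 ≤ count P
count≥1 P i p = count-mono {1} (λ _ → true) P (λ _ → i) (λ _ _ → p) (λ { fzero fzero _ _ _ → refl })

count≥2 : ∀ {n} (P : Fin n → Bool) i j → i ≢ j → T (P i) → T (P j) → 2 ≤ count P
count≥2 {n} P i j i≢j p q = count-mono {2} (λ _ → true) P pick into inj
  where
  pick : Fin 2 → Fin n
  pick fzero = i
  pick (fsuc _) = j
  into : ∀ k → T true → T (P (pick k))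
  into fzero _ = p
  into (fsuc fzero) _ = q
  inj : InjectiveOn (λ _ → true) pick
  inj fzero fzero _ _ _ = refl
  inj fzero (fsuc fzero) _ _ e = ⊥-elim (i≢j e)
  inj (fsuc fzero) fzero _ _ e = ⊥-elim (i≢j (sym e))
  inj (fsuc fzero) (fsuc fzero) _ _ _ = refl

count≥3 : ∀ {n} (P : Fin n → Bool) i j k → i ≢ j → i ≢ k → j ≢ k →
  T (P i) → T (P j) → T (P k) → 3 ≤ count P
count≥3 {n} P i j k i≢j i≢k j≢k p q r = count-mono {3} (λ _ → true) P pick into inj
  where
  pick : Fin 3 → Fin n
  pick fzero = i
  pick (fsuc fzero) = j
  pick (fsuc (fsuc _)) = k
  into : ∀ x → T true → T (P (pick x))
  into fzero _ = p
  into (fsuc fzero) _ = q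
  into (fsuc (fsuc fzero)) _ = r
  inj : InjectiveOn (λ _ → true) pick
  inj fzero fzero _ _ _ = refl
  inj fzero (fsuc fzero) _ _ e = ⊥-elim (i≢j e)
  inj fzero (fsuc (fsuc fzero)) _ _ e = ⊥-elim (i≢k e)
  inj (fsuc fzero) fzero _ _ e = ⊥-elim (i≢j (sym e))
  inj (fsuc fzero) (fsuc fzero) _ _ _ = refl
  inj (fsuc fzero) (fsuc (fsuc fzero)) _ _ e = ⊥-elim (j≢k e)
  inj (fsuc (fsuc fzero)) fzero _ _ e = ⊥-elim (i≢k (sym e))
  inj (fsuc (fsuc fzero)) (fsuc fzero) _ _ e = ⊥-elim (j≢k (sym e))
  inj (fsuc (fsuc fzero)) (fsuc (fsuc fzero)) _ _ _ = refl

witness-of-count≥1 : ∀ {n} (P : Fin n → Bool) → 1 ≤ count P → ∃ λ i → T (P i)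
witness-of-count≥1 {suc n} P h with P fzero in P0
... | true = fzero , subst T (sym P0) tt
... | false with witness-of-count≥1 (P ∘ fsuc) h
...   | i , p = fsuc i , p

witnesses-of-count≥2 : ∀ {n} (P : Fin n → Bool) → 2 ≤ count P →
  ∃ λ i → ∃ λ j → i ≢ j × T (P i) × T (P j)
witnesses-of-count≥2 {suc n} P h with P fzero in P0
... | true with witness-of-count≥1 (P ∘ fsuc) (s≤s⁻¹ h)
...   | i , p = fzero , fsuc i , (λ ()) , subst T (sym P0) tt , p
witnesses-of-count≥2 {suc n} P h | false with witnesses-of-count≥2 (P ∘ fsuc) h
...   | i , j , i≢j , p , q = fsuc i , fsuc j , (λ e → i≢j (suc-injective e)) , p , q

count-differ : ∀ {n} (P Q : Fin n → Bool) → count P ≢ count Q → ∃ λ i → P i ≢ Q i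
count-differ {zero} P Q ne = ⊥-elim (ne refl)
count-differ {suc n} P Q ne with Bool._≟_ (P fzero) (Q fzero)
... | no d = fzero , d
... | yes e with count-differ (P ∘ fsuc) (Q ∘ fsuc)
                  (λ c → ne (cong₂ (λ b r → (if b then 1 else 0) + r) e c))
...   | i , d = fsuc i , d

Fin-if↔T : ∀ b → Fin (if b then 1 else 0) ↔ T b
Fin-if↔T true = 1↔⊤
Fin-if↔T false = 0↔⊥

Σ-Fin-suc : ∀ {K} (P : Fin (suc K) → Bool) →
  Σ (Fin (suc K)) (T ∘ P) ↔ (T (P fzero) ⊎ Σ (Fin K) (T ∘ P ∘ fsuc))
Σ-Fin-suc P = mk↔ₛ′ split join (λ { (inj₁ _) → refl ; (inj₂ _) → refl })
                                (λ { (fzero , _) → refl ; (fsuc _ , _) → refl })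
  where
  split : Σ (Fin _) (T ∘ P) → T (P fzero) ⊎ Σ (Fin _) (T ∘ P ∘ fsuc)
  split (fzero , p) = inj₁ p
  split (fsuc i , p) = inj₂ (i , p)
  join : T (P fzero) ⊎ Σ (Fin _) (T ∘ P ∘ fsuc) → Σ (Fin _) (T ∘ P)
  join (inj₁ p) = fzero , p
  join (inj₂ (i , p)) = fsuc i , p

enumeration : ∀ {K} (P : Fin K → Bool) → Fin (count P) ↔ Σ (Fin K) (T ∘ P)
enumeration {zero} P = mk↔ₛ′ (λ ()) (λ { (() , _) }) (λ { (() , _) }) (λ ())
enumeration {suc K} P =
  ↔-trans +↔⊎ (↔-trans (Fin-if↔T (P fzero) ⊎-↔ enumeration (P ∘ fsuc)) (↔-sym (Σ-Fin-suc P)))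

Σ-prop↔ : ∀ {A : Set} {F : A → Set} (P : A → Bool) →
  (∀ a → F a → T (P a)) → (∀ a → T (P a) → F a) → (∀ a (x y : F a) → x ≡ y) →
  Σ A F ↔ Σ A (T ∘ P)
Σ-prop↔ P to from F-irr = mk↔ₛ′
  (λ (a , x) → a , to a x) (λ (a , p) → a , from a p)
  (λ (a , p) → cong (a ,_) (T-irrelevant _ p)) (λ (a , x) → cong (a ,_) (F-irr a _ x))

triples↔ : ∀ {m} → Fin (m * (m * m)) ↔ (Fin m × Fin m × Fin m)
triples↔ {m} = ↔-trans (*↔× {m}) (↔-refl ×-↔ *↔× {m})

-- 2-paths of a symmetric relation, as represented in ℷ(Σ,Δ): an ordered
-- triple with toℕ a0 < toℕ a2 stands for the unordered 2-path [a0,a1,a2].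
-- (Path2 and Rep do not depend on Δ; it is a parameter only of Gimel.)
module TwoPaths {m : ℕ} (adjΣ : Fin m → Fin m → Bool)
    (symΣ : ∀ {a b} → T (adjΣ a b) → T (adjΣ b a))
    (Δ : Fin m → Fin m → Fin m → Fin m → Set) where
  open Gimel adjΣ Δ

  IsPath : Fin m × Fin m × Fin m → Set
  IsPath (a0 , a1 , a2) = T (adjΣ a0 a1) × T (adjΣ a1 a2) × toℕ a0 < toℕ a2

  IsPath-irrelevant : ∀ t (x y : IsPath t) → x ≡ y
  IsPath-irrelevant (a0 , a1 , a2) (x₁ , x₂ , x₃) (y₁ , y₂ , y₃)
    rewrite T-irrelevant x₁ y₁ | T-irrelevant x₂ y₂ | <-irrelevant x₃ y₃ = refl

  path-≡ : (p q : Path2) → proj₁ p ≡ proj₁ q → p ≡ q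
  path-≡ (t , x) (.t , y) refl = cong (t ,_) (IsPath-irrelevant t x y)

  first middle last : Path2 → Fin m
  first ((a0 , _ , _) , _) = a0
  middle ((_ , a1 , _) , _) = a1
  last ((_ , _ , a2) , _) = a2

  rep-self : (p : Path2) → Rep p (first p) (middle p) (last p)
  rep-self _ = inj₁ (refl , refl , refl)

  rep-reverse : ∀ {p a0 a1 a2} → Rep p a0 a1 a2 → Rep p a2 a1 a0
  rep-reverse (inj₁ e) = inj₂ e
  rep-reverse (inj₂ e) = inj₁ e

  rep-ends-distinct : ∀ {p a0 a1 a2} → Rep p a0 a1 a2 → a0 ≢ a2
  rep-ends-distinct {_ , _ , _ , lt} (inj₁ (refl , refl , refl)) e = <-irrefl (cong toℕ e) lt
  rep-ends-distinct {_ , _ , _ , lt} (inj₂ (refl , refl , refl)) e = <-irrefl (cong toℕ (sym e)) lt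

  rep-agree : ∀ {p a0 a1 a2 b0 b1 b2} → Rep p a0 a1 a2 → Rep p b0 b1 b2 →
    a1 ≡ b1 × ((a0 ≡ b0 × a2 ≡ b2) ⊎ (a0 ≡ b2 × a2 ≡ b0))
  rep-agree (inj₁ (refl , refl , refl)) (inj₁ (refl , refl , refl)) = refl , inj₁ (refl , refl)
  rep-agree (inj₁ (refl , refl , refl)) (inj₂ (refl , refl , refl)) = refl , inj₂ (refl , refl)
  rep-agree (inj₂ (refl , refl , refl)) (inj₁ (refl , refl , refl)) = refl , inj₂ (refl , refl)
  rep-agree (inj₂ (refl , refl , refl)) (inj₂ (refl , refl , refl)) = refl , inj₁ (refl , refl)

  rep-unique : ∀ {p q a0 a1 a2} → Rep p a0 a1 a2 → Rep q a0 a1 a2 → p ≡ q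
  rep-unique {_ , _ , _ , l} {_ , _ , _ , l'} (inj₁ (refl , refl , refl)) (inj₁ (refl , refl , refl)) = path-≡ _ _ refl
  rep-unique {_ , _ , _ , l} {_ , _ , _ , l'} (inj₂ (refl , refl , refl)) (inj₂ (refl , refl , refl)) = path-≡ _ _ refl
  rep-unique {_ , _ , _ , l} {_ , _ , _ , l'} (inj₁ (refl , refl , refl)) (inj₂ (refl , refl , refl)) = ⊥-elim (<-asym l l')
  rep-unique {_ , _ , _ , l} {_ , _ , _ , l'} (inj₂ (refl , refl , refl)) (inj₁ (refl , refl , refl)) = ⊥-elim (<-asym l l')

  path : ∀ a0 a1 a2 → T (adjΣ a0 a1) → T (adjΣ a1 a2) → a0 ≢ a2 → ∃ λ p → Rep p a0 a1 a2
  path a0 a1 a2 t₁ t₂ a0≢a2 with <-cmp (toℕ a0) (toℕ a2)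
  ... | tri< l _ _ = ((a0 , a1 , a2) , t₁ , t₂ , l) , inj₁ (refl , refl , refl)
  ... | tri≈ _ e _ = ⊥-elim (a0≢a2 (toℕ-injective e))
  ... | tri> _ _ l = ((a2 , a1 , a0) , symΣ t₂ , symΣ t₁ , l) , inj₂ (refl , refl , refl)

  path-edges : (p : Path2) → T (adjΣ (first p) (middle p)) × T (adjΣ (middle p) (last p)) × first p ≢ last p
  path-edges p@(_ , t₁ , t₂ , _) = t₁ , t₂ , rep-ends-distinct {p} (rep-self p)

  isPathᵇ : Fin m × Fin m × Fin m → Bool
  isPathᵇ (a0 , a1 , a2) = adjΣ a0 a1 ∧ (adjΣ a1 a2 ∧ (toℕ a0 <ᵇ toℕ a2))

  IsPath⇒ᵇ : ∀ t → IsPath t → T (isPathᵇ t)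
  IsPath⇒ᵇ (a0 , a1 , a2) (t₁ , t₂ , l) = ∧-intro t₁ (∧-intro t₂ (<⇒<ᵇ l))

  ᵇ⇒IsPath : ∀ t → T (isPathᵇ t) → IsPath t
  ᵇ⇒IsPath (a0 , a1 , a2) p with ∧-elim {adjΣ a0 a1} p
  ... | t₁ , q with ∧-elim {adjΣ a1 a2} q
  ...   | t₂ , l = t₁ , t₂ , <ᵇ⇒< (toℕ a0) (toℕ a2) l

  #paths : ℕ
  #paths = count (isPathᵇ ∘ Inverse.to triples↔)

  paths↔ : Fin #paths ↔ Path2
  paths↔ = ↔-trans (enumeration (isPathᵇ ∘ Inverse.to triples↔))
           (↔-trans (Σ-↔ triples↔ ↔-refl) (↔-sym (Σ-prop↔ isPathᵇ IsPath⇒ᵇ ᵇ⇒IsPath IsPath-irrelevant)))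

module QuotientFacts {n : ℕ} (adj : Fin n → Fin n → Bool) {k : ℕ} (g : Fin n → Fin k) where
  open Quot adj g

  qadj-intro : ∀ {u w a b} → g u ≡ a → g w ≡ b → T (adj u w) → a ≢ b → T (qadj a b)
  qadj-intro {u} {w} {a} {b} gu gw t a≢b =
    ∧-intro (distinct (a ≟ b)) (anyF-intro _ u (anyF-intro _ w
      (∧-intro (≡⇒== gu) (∧-intro (≡⇒== gw) t))))
    where
    distinct : (d : Dec (a ≡ b)) → T (if isYes d then false else true)
    distinct (yes a≡b) = a≢b a≡b
    distinct (no _) = tt

  qadj-elim : ∀ {a b} → T (qadj a b) → a ≢ b × ∃ λ u → ∃ λ w → g u ≡ a × g w ≡ b × T (adj u w)
  qadj-elim {a} {b} t with ∧-elim {if a == b then false else true} t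
  ... | d , t' with anyF-elim _ t'
  ...   | u , t'' with anyF-elim _ t''
  ...     | w , s with ∧-elim {g u == a} s
  ...       | gu , s' with ∧-elim {g w == b} s'
  ...         | gw , e = distinct (a ≟ b) d , u , w , ==⇒≡ gu , ==⇒≡ gw , e
    where
    distinct : (dec : Dec (a ≡ b)) → T (if isYes dec then false else true) → a ≢ b
    distinct (no a≢b) _ = a≢b

  inN-intro : ∀ {u w C} → g w ≡ C → T (adj u w) → T (inN u C)
  inN-intro {w = w} gw t = anyF-intro _ w (∧-intro (≡⇒== gw) t)

  inN-elim : ∀ {u C} → T (inN u C) → ∃ λ w → g w ≡ C × T (adj u w)
  inN-elim {u} t with anyF-elim _ t
  ... | w , s with ∧-elim {g w == _} s
  ...   | gw , e = w , ==⇒≡ gw , e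

module BlockAction {c ℓ : Level} {X : Group c ℓ} {n : ℕ} (A : Action X n)
    {m : ℕ} (f : Fin n → Fin m) (surj : ∀ a → ∃ λ u → f u ≡ a) (inv : Act.Invariant A f) where
  open Group X using (Carrier; _∙_; _⁻¹; inverseˡ; inverseʳ)
  open Action A
  open Act A using (MapsPart)

  act-inverseˡ : ∀ x u → act (x ⁻¹) (act x u) ≡ u
  act-inverseˡ x u = trans (sym (act-∙ (x ⁻¹) x u)) (trans (act-cong (inverseˡ x) u) (act-ε u))

  act-inverseʳ : ∀ x u → act x (act (x ⁻¹) u) ≡ u
  act-inverseʳ x u = trans (sym (act-∙ x (x ⁻¹) u)) (trans (act-cong (inverseʳ x) u) (act-ε u))

  member : Fin m → Fin n
  member a = proj₁ (surj a)

  member-in : ∀ a → f (member a) ≡ a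
  member-in a = proj₂ (surj a)

  maps-block-of : ∀ x {w a} → f w ≡ a → MapsPart f x a (f (act x w))
  maps-block-of x fw u fu = inv x u _ (trans fu (sym fw))

  image : Carrier → Fin m → Fin m
  image x a = f (act x (member a))

  maps-image : ∀ x a → MapsPart f x a (image x a)
  maps-image x a = maps-block-of x (member-in a)

  maps-via : ∀ {x u v a b} → act x u ≡ v → f u ≡ a → f v ≡ b → MapsPart f x a b
  maps-via {x} xu≡v fu fv = subst (MapsPart f x _) (trans (cong f xu≡v) fv) (maps-block-of x fu)

  maps-functional : ∀ {x a b b'} → MapsPart f x a b → MapsPart f x a b' → b ≡ b'
  maps-functional {a = a} h h' = trans (sym (h _ (member-in a))) (h' _ (member-in a))

  maps-inverse : ∀ {x a b} → MapsPart f x a b → MapsPart f (x ⁻¹) b a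
  maps-inverse {x} {a} h u fu =
    trans (inv (x ⁻¹) u (act x (member a)) (trans fu (sym (h _ (member-in a)))))
          (trans (cong f (act-inverseˡ x (member a))) (member-in a))

  maps-injective : ∀ {x a a' b} → MapsPart f x a b → MapsPart f x a' b → a ≡ a'
  maps-injective h h' = maps-functional (maps-inverse h) (maps-inverse h')

  maps-distinct : ∀ {x a a' b b'} → MapsPart f x a b → MapsPart f x a' b' → a ≢ a' → b ≢ b'
  maps-distinct h h' a≢a' b≡b' = a≢a' (maps-injective h (subst (MapsPart f _ _) (sym b≡b') h'))

  maps-compose : ∀ {x y a b c'} → MapsPart f x a b → MapsPart f y b c' → MapsPart f (y ∙ x) a c'
  maps-compose {x} {y} h h' u fu = trans (cong f (act-∙ y x u)) (h' (act x u) (h u fu))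

module SymmetricFacts {c ℓ : Level} {X : Group c ℓ} {n : ℕ} (Γ : Graph n) (A : Action X n)
    {m : ℕ} (f : Fin n → Fin m) (surj : ∀ a → ∃ λ u → f u ≡ a) (inv : Act.Invariant A f)
    (symmetric : Act.Symmetric A (Graph.adj Γ)) where
  open Group X using (_⁻¹)
  open Action A
  open Act A using (MapsPart)
  open Quot (Graph.adj Γ) f
  open QuotientFacts (Graph.adj Γ) f
  open BlockAction A f surj inv

  Adj : Fin n → Fin n → Set
  Adj u w = T (Graph.adj Γ u w)

  Sees : Fin n → Fin m → Set
  Sees u C = T (inN u C)

  InTriple : Fin n → Fin m → Fin m → Fin m → Set
  InTriple u D B C = Sees u D × f u ≡ B × Sees u C

  adj-sym : ∀ {u w} → Adj u w → Adj w u
  adj-sym {u} {w} = subst T (Graph.sym Γ u w)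

  act-adj : ∀ x {u w} → Adj u w → Adj (act x u) (act x w)
  act-adj x {u} {w} = subst T (sym (proj₁ symmetric x u w))

  vertex-transitive : ∀ u v → ∃ λ x → act x u ≡ v
  vertex-transitive = proj₁ (proj₂ symmetric)

  arc-transitive : ∀ u w u' w' → Adj u w → Adj u' w' → ∃ λ x → act x u ≡ u' × act x w ≡ w'
  arc-transitive = proj₂ (proj₂ symmetric)

  qadj-sym : ∀ {a b} → T (qadj a b) → T (qadj b a)
  qadj-sym t with qadj-elim t
  ... | a≢b , u , w , fu , fw , e = qadj-intro fw fu (adj-sym e) (λ b≡a → a≢b (sym b≡a))

  sees-transport : ∀ {x u a b} → Sees u a → MapsPart f x a b → Sees (act x u) b
  sees-transport {x} s h with inN-elim s
  ... | w , fw , e = inN-intro (h w fw) (act-adj x e)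

  sees-via : ∀ {x u v a b} → act x u ≡ v → Sees u a → MapsPart f x a b → Sees v b
  sees-via xu≡v s h = subst (λ z → Sees z _) xu≡v (sees-transport s h)

  qadj-transport : ∀ {x a b a' b'} → T (qadj a b) → MapsPart f x a a' → MapsPart f x b b' → T (qadj a' b')
  qadj-transport {x} t ha hb with qadj-elim t
  ... | a≢b , u , w , fu , fw , e = qadj-intro (ha u fu) (hb w fw) (act-adj x e) (maps-distinct ha hb a≢b)

  triple-transport : ∀ {x u D B C D' B' C'} → MapsPart f x D D' → MapsPart f x B B' → MapsPart f x C C' →
    InTriple u D B C → InTriple (act x u) D' B' C'
  triple-transport {u = u} hD hB hC (sD , fu , sC) = sees-transport sD hD , hB u fu , sees-transport sC hC

  inTripleᵇ : Fin m → Fin m → Fin m → Fin n → Bool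
  inTripleᵇ D B C u = inN u D ∧ ((f u == B) ∧ inN u C)

  triple⇒ᵇ : ∀ {D B C u} → InTriple u D B C → T (inTripleᵇ D B C u)
  triple⇒ᵇ (sD , fu , sC) = ∧-intro sD (∧-intro (≡⇒== fu) sC)

  ᵇ⇒triple : ∀ {D B C u} → T (inTripleᵇ D B C u) → InTriple u D B C
  ᵇ⇒triple {D} {B} {C} {u} t with ∧-elim {inN u D} t
  ... | sD , t' with ∧-elim {f u == B} t'
  ...   | fu , sC = sD , ==⇒≡ fu , sC

  -- λ is an X-invariant of the triple (D, B, C): x is a bijection between the two sets.
  lamSize-invariant : ∀ {x D B C D' B' C'} → MapsPart f x D D' → MapsPart f x B B' → MapsPart f x C C' →
    lamSize D B C ≡ lamSize D' B' C'
  lamSize-invariant {x} hD hB hC = count-bijection _ _ (act x) (act (x ⁻¹))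
    (act-inverseˡ x) (act-inverseʳ x)
    (λ u t → triple⇒ᵇ (triple-transport hD hB hC (ᵇ⇒triple t)))
    (λ u t → triple⇒ᵇ (triple-transport (maps-inverse hD) (maps-inverse hB) (maps-inverse hC) (ᵇ⇒triple t)))

module Setting {c ℓ : Level} {X : Group c ℓ} {n m : ℕ} (Γ : Graph n) (A : Action X n)
    (f : Fin n → Fin m) (B₀ : Fin m)
    (symmetric : Act.Symmetric A (Graph.adj Γ))
    (surj : ∀ a → ∃ λ u → f u ≡ a)
    (inv : Act.Invariant A f)
    (not-multicover : ∀ B C → T (Quot.qadj (Graph.adj Γ) f B C) →
       Quot.kSize (Graph.adj Γ) f B C ≢ Quot.size (Graph.adj Γ) f B)
    (valency : ∀ B → 3 ≤ Quot.valQ (Graph.adj Γ) f B)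
    (r≡2 : ∀ v → Quot.rSize (Graph.adj Γ) f v ≡ 2)
    (nonempty-at-B₀ : ∀ D C → Quot.IsPath2 (Graph.adj Γ) f D B₀ C →
       ∃ λ u → T (Quot.inN (Graph.adj Γ) f u D) × f u ≡ B₀ × T (Quot.inN (Graph.adj Γ) f u C)) where
  open Group X using (Carrier; _∙_; _⁻¹)
  open Action A
  open Act A using (MapsPart; TwoArcTransQ; SelfPairedOrbit3; IsArc3)
  open Quot (Graph.adj Γ) f
  open QuotientFacts (Graph.adj Γ) f
  open BlockAction A f surj inv
  open SymmetricFacts Γ A f surj inv symmetric

  maps-onto : ∀ {x a b} → image x a ≡ b → MapsPart f x a b
  maps-onto {x} {a} e = subst (MapsPart f x a) e (maps-image x a)

  -- Every edge of Γ joins two different blocks: some edge does (b ≥ 1),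
  -- and X is transitive on the edges.
  quotient-edge-at : ∀ B → ∃ λ u → ∃ λ w → f u ≢ f w × Adj u w
  quotient-edge-at B with witness-of-count≥1 (qadj B) (≤-trans (s≤s z≤n) (valency B))
  ... | C , t with qadj-elim t
  ...   | B≢C , u , w , fu , fw , e = u , w , (λ fu≡fw → B≢C (trans (sym fu) (trans fu≡fw fw))) , e

  blocks-independent : ∀ {u w} → Adj u w → f u ≢ f w
  blocks-independent {u} {w} e fu≡fw with quotient-edge-at (f u)
  ... | u' , w' , fu'≢fw' , e' with arc-transitive u w u' w' e e'
  ...   | x , xu , xw = fu'≢fw' (trans (sym (cong f xu)) (trans (inv x u w fu≡fw) (cong f xw)))

  edge-sees : ∀ {u w} → Adj u w → Sees u (f w)
  edge-sees = inN-intro refl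

  sees-other : ∀ {u C} → Sees u C → f u ≢ C
  sees-other s fu≡C with inN-elim s
  ... | w , fw , e = blocks-independent e (trans fu≡C (sym fw))

  sees⇒qadj : ∀ {u C} → Sees u C → T (qadj (f u) C)
  sees⇒qadj s with inN-elim s
  ... | w , fw , e = qadj-intro refl fw e (sees-other s)

  record Neighbourhood (u : Fin n) : Set where
    field
      left right : Fin m
      distinct   : left ≢ right
      sees-left  : Sees u left
      sees-right : Sees u right

  opaque
    neighbourhood : ∀ u → Neighbourhood u
    neighbourhood u with witnesses-of-count≥2 (inN u) (subst (2 ≤_) (sym (r≡2 u)) ≤-refl)
    ... | C , D , C≢D , sC , sD = record { left = C ; right = D ; distinct = C≢D ; sees-left = sC ; sees-right = sD }

  sees-one-of-two : ∀ {v C D E} → C ≢ D → Sees v C → Sees v D → Sees v E → E ≢ D → E ≡ C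
  sees-one-of-two {v} {C} {D} {E} C≢D sC sD sE E≢D with E ≟ C
  ... | yes E≡C = E≡C
  ... | no E≢C = ⊥-elim (3≰2 (subst (3 ≤_) (r≡2 v)
          (count≥3 (inN v) C D E C≢D (λ e → E≢C (sym e)) (λ e → E≢D (sym e)) sC sD sE)))
    where
    3≰2 : ¬ 3 ≤ 2
    3≰2 (s≤s (s≤s ()))

  another-block : ∀ u B → ∃ λ C → Sees u C × C ≢ B
  another-block u B with B ≟ Neighbourhood.left (neighbourhood u)
  ... | yes B≡l = right , sees-right , (λ r≡B → distinct (trans (sym B≡l) (sym r≡B)))
    where open Neighbourhood (neighbourhood u)
  ... | no B≢l = left , sees-left , (λ l≡B → B≢l (sym l≡B))
    where open Neighbourhood (neighbourhood u)

  -- Since X is transitive on blocks, the hypothesis at B₀ holds at every block.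
  triple-nonempty : ∀ {D B C} → IsPath2 D B C → ∃ λ u → InTriple u D B C
  triple-nonempty {D} {B} {C} (t₁ , t₂ , D≢C) with vertex-transitive (member B) (member B₀)
  ... | x , x-moves with maps-via x-moves (member-in B) (member-in B₀)
  ...   | B↦B₀ with nonempty-at-B₀ (image x D) (image x C)
                      (qadj-transport t₁ (maps-image x D) B↦B₀ , qadj-transport t₂ B↦B₀ (maps-image x C) ,
                       maps-distinct (maps-image x D) (maps-image x C) D≢C)
  ...     | u , in-triple = act (x ⁻¹) u ,
    triple-transport (maps-inverse (maps-image x D)) (maps-inverse B↦B₀) (maps-inverse (maps-image x C)) in-triple

  swap-at : ∀ {v C D} → C ≢ D → Sees v C → Sees v D →
    ∃ λ y → act y v ≡ v × MapsPart f y C D × MapsPart f y D C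
  swap-at {v} {C} {D} C≢D sC sD with inN-elim sC | inN-elim sD
  ... | wC , fwC , eC | wD , fwD , eD with arc-transitive v wC v wD eC eD
  ...   | y , yv , ywC = y , yv , C↦D , maps-onto D↦C
    where
    C↦D : MapsPart f y C D
    C↦D = maps-via ywC fwC fwD
    D↦C : image y D ≡ C
    D↦C = sees-one-of-two C≢D sC sD (sees-via yv sD (maps-image y D))
            (maps-distinct (maps-image y D) C↦D (λ D≡C → C≢D (sym D≡C)))

  -- Any two "vertex-witnessed" 2-arcs of Γ_f are related by an element of X:
  -- move u to v, then, if needed, swap the two blocks seen by v.
  two-arc-through : ∀ {u v a0 a1 a2 c0 c1 c2} → a0 ≢ a2 → c0 ≢ c2 →
    InTriple u a0 a1 a2 → InTriple v c0 c1 c2 →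
    ∃ λ x → MapsPart f x a0 c0 × MapsPart f x a1 c1 × MapsPart f x a2 c2
  two-arc-through {u} {v} {a0} {a1} {a2} {c0} {c1} {c2} a0≢a2 c0≢c2 (s0 , fu , s2) (t0 , fv , t2)
    with vertex-transitive u v
  ... | x , xu≡v with image x a0 ≟ c2
  ...   | no x0≢c2 = x , maps-onto x0≡c0 , a1↦c1 , maps-onto x2≡c2
    where
    a1↦c1 : MapsPart f x a1 c1
    a1↦c1 = maps-via xu≡v fu fv
    x0≡c0 : image x a0 ≡ c0
    x0≡c0 = sees-one-of-two c0≢c2 t0 t2 (sees-via xu≡v s0 (maps-image x a0)) x0≢c2
    x2≢c0 : image x a2 ≢ c0
    x2≢c0 e = maps-distinct (maps-image x a2) (maps-image x a0) (λ e' → a0≢a2 (sym e')) (trans e (sym x0≡c0))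
    x2≡c2 : image x a2 ≡ c2
    x2≡c2 = sees-one-of-two (λ e → c0≢c2 (sym e)) t2 t0 (sees-via xu≡v s2 (maps-image x a2)) x2≢c0
  ...   | yes x0≡c2 with swap-at c0≢c2 t0 t2
  ...     | y , yv , c0↦c2 , c2↦c0 =
    y ∙ x , maps-compose (maps-onto x0≡c2) c2↦c0 , maps-compose (maps-via xu≡v fu fv) (maps-via yv fv fv) ,
            maps-compose (maps-onto x2≡c0) c0↦c2
    where
    x2≢c2 : image x a2 ≢ c2
    x2≢c2 e = maps-distinct (maps-image x a2) (maps-image x a0) (λ e' → a0≢a2 (sym e')) (trans e (sym x0≡c2))
    x2≡c0 : image x a2 ≡ c0
    x2≡c0 = sees-one-of-two c0≢c2 t0 t2 (sees-via xu≡v s2 (maps-image x a2)) x2≢c2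

  two-arc-transitive : TwoArcTransQ (Graph.adj Γ) f
  two-arc-transitive = on-blocks , on-arcs , on-2-arcs
    where
    on-blocks : ∀ a b → ∃ λ x → MapsPart f x a b
    on-blocks a b with vertex-transitive (member a) (member b)
    ... | x , e = x , maps-via e (member-in a) (member-in b)
    on-arcs : ∀ a0 a1 c0 c1 → T (qadj a0 a1) → T (qadj c0 c1) →
      ∃ λ x → MapsPart f x a0 c0 × MapsPart f x a1 c1
    on-arcs _ _ _ _ ta tc with qadj-elim ta | qadj-elim tc
    ... | _ , u , w , fu , fw , e | _ , u' , w' , fu' , fw' , e' with arc-transitive u w u' w' e e'
    ...   | x , xu , xw = x , maps-via xu fu fu' , maps-via xw fw fw'
    on-2-arcs : ∀ a0 a1 a2 c0 c1 c2 → T (qadj a0 a1) → T (qadj a1 a2) → a0 ≢ a2 →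
      T (qadj c0 c1) → T (qadj c1 c2) → c0 ≢ c2 →
      ∃ λ x → MapsPart f x a0 c0 × MapsPart f x a1 c1 × MapsPart f x a2 c2
    on-2-arcs _ _ _ _ _ _ t₁ t₂ a0≢a2 t₃ t₄ c0≢c2 = two-arc-through a0≢a2 c0≢c2
      (proj₂ (triple-nonempty (t₁ , t₂ , a0≢a2))) (proj₂ (triple-nonempty (t₃ , t₄ , c0≢c2)))

  Δ : Fin m → Fin m → Fin m → Fin m → Set
  Δ = DeltaDef.Δ (Graph.adj Γ) f

  -- Δ is nonempty: any arc (v, u) of Γ extends to an element of Δ, as r = 2.
  Δ-nonempty : ∃ λ a0 → ∃ λ a1 → ∃ λ a2 → ∃ λ a3 → Δ a0 a1 a2 a3
  Δ-nonempty with quotient-edge-at B₀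
  ... | v , u , _ , e with another-block v (f u) | another-block u (f v)
  ...   | C , sC , C≢fu | D , sD , D≢fv = C , f v , f u , D , v , u , e , refl , refl , sC , sD , C≢fu , D≢fv

  Δ-arcs : ∀ a0 a1 a2 a3 → Δ a0 a1 a2 a3 → IsArc3 (Graph.adj Γ) f a0 a1 a2 a3
  Δ-arcs _ _ _ _ (v , u , e , refl , refl , sC , sD , C≢fu , D≢fv) =
    qadj-sym (sees⇒qadj sC) , sees⇒qadj (edge-sees e) , sees⇒qadj sD , C≢fu , (λ fv≡D → D≢fv (sym fv≡D))

  Δ-closed : ∀ a0 a1 a2 a3 (x : Carrier) c0 c1 c2 c3 → Δ a0 a1 a2 a3 →
    MapsPart f x a0 c0 → MapsPart f x a1 c1 → MapsPart f x a2 c2 → MapsPart f x a3 c3 → Δ c0 c1 c2 c3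
  Δ-closed _ _ _ _ x _ _ _ _ (v , u , e , fv , fu , sC , sD , C≢fu , D≢fv) h0 h1 h2 h3 =
    act x v , act x u , act-adj x e , h1 v fv , h2 u fu , sees-transport sC h0 , sees-transport sD h3 ,
    maps-distinct h0 h2 C≢fu , maps-distinct h3 h1 D≢fv

  -- Map the arc (v, u) onto (v', u'); since r = 2, the outer blocks follow.
  Δ-transitive : ∀ a0 a1 a2 a3 c0 c1 c2 c3 → Δ a0 a1 a2 a3 → Δ c0 c1 c2 c3 →
    ∃ λ x → MapsPart f x a0 c0 × MapsPart f x a1 c1 × MapsPart f x a2 c2 × MapsPart f x a3 c3
  Δ-transitive a0 a1 a2 a3 c0 c1 c2 c3 (v , u , e , fv , fu , sC , sD , C≢fu , D≢fv)
                                       (v' , u' , e' , fv' , fu' , sC' , sD' , C'≢fu' , D'≢fv')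
    with arc-transitive v u v' u' e e'
  ... | x , xv , xu = x , maps-onto x0≡c0 , a1↦c1 , a2↦c2 , maps-onto x3≡c3
    where
    a1↦c1 : MapsPart f x a1 c1
    a1↦c1 = maps-via xv fv fv'
    a2↦c2 : MapsPart f x a2 c2
    a2↦c2 = maps-via xu fu fu'
    x0≡c0 : image x a0 ≡ c0
    x0≡c0 = sees-one-of-two C'≢fu' sC' (inN-intro fu' e') (sees-via xv sC (maps-image x a0))
              (maps-distinct (maps-image x a0) a2↦c2 C≢fu)
    x3≡c3 : image x a3 ≡ c3
    x3≡c3 = sees-one-of-two D'≢fv' sD' (inN-intro fv' (adj-sym e')) (sees-via xu sD (maps-image x a3))
              (maps-distinct (maps-image x a3) a1↦c1 D≢fv)

  Δ-reverse : ∀ a0 a1 a2 a3 → Δ a0 a1 a2 a3 → Δ a3 a2 a1 a0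
  Δ-reverse _ _ _ _ (v , u , e , fv , fu , sC , sD , C≢fu , D≢fv) =
    u , v , adj-sym e , fu , fv , sD , sC , D≢fv , C≢fu

  Δ-self-paired-orbit : SelfPairedOrbit3 (Graph.adj Γ) f Δ
  Δ-self-paired-orbit = Δ-nonempty , Δ-arcs , Δ-closed , Δ-transitive , Δ-reverse

  -- λ = |Γ(D) ∩ B ∩ Γ(C)| is the same for all 2-paths [D, B, C]; we measure
  -- it on the 2-path [left, B₀, right] through a reference vertex u₀ ∈ B₀.
  u₀ : Fin n
  u₀ = member B₀

  open Neighbourhood (neighbourhood u₀) using ()
    renaming (left to D₀; right to C₀; distinct to D₀≢C₀; sees-left to u₀-sees-D₀; sees-right to u₀-sees-C₀)

  u₀-in-triple : InTriple u₀ D₀ (f u₀) C₀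
  u₀-in-triple = u₀-sees-D₀ , refl , u₀-sees-C₀

  λ₀ : ℕ
  λ₀ = lamSize D₀ (f u₀) C₀

  λ-constant : ∀ D B C → IsPath2 D B C → lamSize D B C ≡ λ₀
  λ-constant D B C p =
    let (_ , hD , hB , hC) = two-arc-through D₀≢C₀ (proj₂ (proj₂ p)) u₀-in-triple (proj₂ (triple-nonempty p))
    in sym (lamSize-invariant hD hB hC)

  λ-positive : 1 ≤ λ₀
  λ-positive = count≥1 _ u₀ (triple⇒ᵇ u₀-in-triple)

  open Gimel qadj Δ
  open TwoPaths qadj qadj-sym Δ

  -- Kept opaque: only the triple describing pathOf u is ever used, and
  -- unfolding the construction would make type checking very slow.
  opaque
    pathOf-with-rep : ∀ u → ∃ λ p → Rep p (Neighbourhood.left (neighbourhood u)) (f u)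
                                        (Neighbourhood.right (neighbourhood u))
    pathOf-with-rep u = path left (f u) right (qadj-sym (sees⇒qadj sees-left)) (sees⇒qadj sees-right) distinct
      where open Neighbourhood (neighbourhood u)

  pathOf : Fin n → Path2
  pathOf u = proj₁ (pathOf-with-rep u)

  pathOf-rep : ∀ u → Rep (pathOf u) (Neighbourhood.left (neighbourhood u)) (f u)
                                    (Neighbourhood.right (neighbourhood u))
  pathOf-rep u = proj₂ (pathOf-with-rep u)

  orient : ∀ {v L R a0 a2} → L ≢ R → Sees v L → Sees v R → Sees v a0 → Sees v a2 → a0 ≢ a2 →
    (a0 ≡ L × a2 ≡ R) ⊎ (a0 ≡ R × a2 ≡ L)
  orient {L = L} {R} {a0} {a2} L≢R sL sR s0 s2 a0≢a2 with a0 ≟ R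
  ... | yes a0≡R = inj₂ (a0≡R , sees-one-of-two L≢R sL sR s2 (λ e → a0≢a2 (trans a0≡R (sym e))))
  ... | no a0≢R = inj₁ (a0≡L , sees-one-of-two (λ e → L≢R (sym e)) sR sL s2 (λ e → a0≢a2 (trans a0≡L (sym e))))
    where
    a0≡L : a0 ≡ L
    a0≡L = sees-one-of-two L≢R sL sR s0 a0≢R

  on-pathOf : ∀ {u a0 a1 a2} → InTriple u a0 a1 a2 → a0 ≢ a2 → Rep (pathOf u) a0 a1 a2
  on-pathOf {u} (s0 , refl , s2) a0≢a2 with orient distinct sees-left sees-right s0 s2 a0≢a2
    where open Neighbourhood (neighbourhood u)
  ... | inj₁ (refl , refl) = pathOf-rep u
  ... | inj₂ (refl , refl) = rep-reverse {pathOf u} (pathOf-rep u)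

  pathOf-on : ∀ {u a0 a1 a2} → Rep (pathOf u) a0 a1 a2 → InTriple u a0 a1 a2
  pathOf-on {u} r with rep-agree {pathOf u} r (pathOf-rep u)
  ... | refl , inj₁ (refl , refl) = sees-left , refl , sees-right
    where open Neighbourhood (neighbourhood u)
  ... | refl , inj₂ (refl , refl) = sees-right , refl , sees-left
    where open Neighbourhood (neighbourhood u)

  fibre⇒triple : ∀ {p a0 a1 a2 u} → Rep p a0 a1 a2 → pathOf u ≡ p → InTriple u a0 a1 a2
  fibre⇒triple r refl = pathOf-on r

  triple⇒fibre : ∀ {p a0 a1 a2 u} → Rep p a0 a1 a2 → InTriple u a0 a1 a2 → pathOf u ≡ p
  triple⇒fibre {p} r t = rep-unique {pathOf _} {p} (on-pathOf t (rep-ends-distinct {p} r)) r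

  same-triple⇒same-path : ∀ {u v a0 a1 a2} → a0 ≢ a2 → InTriple u a0 a1 a2 → InTriple v a0 a1 a2 →
    pathOf u ≡ pathOf v
  same-triple⇒same-path a0≢a2 tu tv = triple⇒fibre (on-pathOf tv a0≢a2) tu

  same-path⇒same-block : ∀ {u v} → pathOf u ≡ pathOf v → f u ≡ f v
  same-path⇒same-block {u} {v} e =
    trans (proj₁ (proj₂ (fibre⇒triple (rep-self (pathOf v)) e)))
          (sym (proj₁ (proj₂ (fibre⇒triple (rep-self (pathOf v)) refl))))

  vertexOn : Path2 → Fin n
  vertexOn p = proj₁ (triple-nonempty (path-edges p))

  pathOf-vertexOn : ∀ p → pathOf (vertexOn p) ≡ p
  pathOf-vertexOn p = triple⇒fibre (rep-self p) (proj₂ (triple-nonempty (path-edges p)))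

  gimel-edge : ∀ {u v} → Adj u v → gadj (pathOf u) (pathOf v)
  gimel-edge {u} {v} e with another-block u (f v) | another-block v (f u)
  ... | C , sC , C≢fv | D , sD , D≢fu =
    C , f u , f v , D , (u , v , e , refl , refl , sC , sD , C≢fv , D≢fu) ,
    inj₁ (on-pathOf (sC , refl , edge-sees e) C≢fv , on-pathOf (edge-sees (adj-sym e) , refl , sD) (λ e' → D≢fu (sym e')))

  gimel-edge⁻ : ∀ {p q} → gadj p q → ∃ λ v → ∃ λ w → pathOf v ≡ p × pathOf w ≡ q × Adj v w
  gimel-edge⁻ (_ , _ , _ , _ , (v , u , e , fv , fu , sC , sD , _ , _) , inj₁ (rp , rq)) =
    v , u , triple⇒fibre rp (sC , fv , inN-intro fu e) , triple⇒fibre rq (inN-intro fv (adj-sym e) , fu , sD) , e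
  gimel-edge⁻ (_ , _ , _ , _ , (v , u , e , fv , fu , sC , sD , _ , _) , inj₂ (rq , rp)) =
    u , v , triple⇒fibre rp (inN-intro fv (adj-sym e) , fu , sD) , triple⇒fibre rq (sC , fv , inN-intro fu e) , adj-sym e

  -- Case λ = 1: the fibres of pathOf are single vertices, so pathOf is an
  -- isomorphism Γ ≅ ℷ(Γ_f, Δ).
  triple-singleton : λ₀ ≡ 1 → ∀ {D B C u w} → IsPath2 D B C → InTriple u D B C → InTriple w D B C → u ≡ w
  triple-singleton λ≡1 {D} {B} {C} {u} {w} p tu tw with u ≟ w
  ... | yes u≡w = u≡w
  ... | no u≢w = ⊥-elim (2≰1 (subst (2 ≤_) (trans (λ-constant D B C p) λ≡1)
                                  (count≥2 _ u w u≢w (triple⇒ᵇ tu) (triple⇒ᵇ tw))))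
    where
    2≰1 : ¬ 2 ≤ 1
    2≰1 (s≤s ())

  vertexOn-pathOf : λ₀ ≡ 1 → ∀ u → vertexOn (pathOf u) ≡ u
  vertexOn-pathOf λ≡1 u = triple-singleton λ≡1 (path-edges (pathOf u))
    (fibre⇒triple (rep-self (pathOf u)) (pathOf-vertexOn (pathOf u)))
    (fibre⇒triple (rep-self (pathOf u)) refl)

  case-λ≡1 : λ₀ ≡ 1 → Iso Adj gadj
  case-λ≡1 λ≡1 = pathOf , vertexOn , vertexOn-pathOf λ≡1 , pathOf-vertexOn ,
                 (λ u v → gimel-edge , reflect u v)
    where
    pathOf-injective : ∀ {u v} → pathOf u ≡ pathOf v → u ≡ v
    pathOf-injective {u} {v} e = trans (sym (vertexOn-pathOf λ≡1 u)) (trans (cong vertexOn e) (vertexOn-pathOf λ≡1 v))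
    reflect : ∀ u v → gadj (pathOf u) (pathOf v) → Adj u v
    reflect u v g with gimel-edge⁻ g
    ... | u' , v' , e₁ , e₂ , e = subst₂ Adj (pathOf-injective e₁) (pathOf-injective e₂) e

  -- Case λ ≥ 2: 𝒬 is the partition of V(Γ) into the fibres of pathOf,
  -- with parts indexed by Fin #paths.
  opaque
    encode : Path2 → Fin #paths
    encode = Inverse.from paths↔

    decode : Fin #paths → Path2
    decode = Inverse.to paths↔

    decode-encode : ∀ p → decode (encode p) ≡ p
    decode-encode = Inverse.strictlyInverseˡ paths↔

    encode-decode : ∀ j → encode (decode j) ≡ j
    encode-decode = Inverse.strictlyInverseʳ paths↔

  encode-injective : ∀ {p p'} → encode p ≡ encode p' → p ≡ p'
  encode-injective {p} {p'} e = trans (sym (decode-encode p)) (trans (cong decode e) (decode-encode p'))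

  part : Fin n → Fin #paths
  part u = encode (pathOf u)

  part-is-triple : ∀ {p a0 a1 a2} → Rep p a0 a1 a2 → ∀ u →
    (part u ≡ encode p → InTriple u a0 a1 a2) × (InTriple u a0 a1 a2 → part u ≡ encode p)
  part-is-triple {p} r u = (λ e → fibre⇒triple {p} r (encode-injective {pathOf u} {p} e)) ,
                          (λ t → cong encode (triple⇒fibre {p} r t))

  parts-nonempty : ∀ j → ∃ λ u → part u ≡ j
  parts-nonempty j = vertexOn (decode j) , trans (cong encode (pathOf-vertexOn (decode j))) (encode-decode j)

  -- 𝒬 is X-invariant: x maps Γ(a0) ∩ a1 ∩ Γ(a2) into the analogous set of the image blocks.
  part-invariant : Act.Invariant A part
  part-invariant x u v e = cong encode (same-triple⇒same-path
      (maps-distinct (maps-image x a0) (maps-image x a2) (rep-ends-distinct {pathOf v} (rep-self (pathOf v))))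
      (moved (fibre⇒triple {pathOf v} (rep-self (pathOf v)) (encode-injective {pathOf u} {pathOf v} e)))
      (moved (fibre⇒triple (rep-self (pathOf v)) refl)))
    where
    a0 a1 a2 : Fin m
    a0 = first (pathOf v)
    a1 = middle (pathOf v)
    a2 = last (pathOf v)
    moved : ∀ {w} → InTriple w a0 a1 a2 → InTriple (act x w) (image x a0) (image x a1) (image x a2)
    moved = triple-transport (maps-image x a0) (maps-image x a1) (maps-image x a2)

  part-refines : ∀ u v → part u ≡ part v → f u ≡ f v
  part-refines u v e = same-path⇒same-block (encode-injective {pathOf u} {pathOf v} e)

  part-nontrivial : 2 ≤ λ₀ → ∃ λ u → ∃ λ v → u ≢ v × part u ≡ part v
  part-nontrivial λ≥2 with witnesses-of-count≥2 (inTripleᵇ D₀ (f u₀) C₀) λ≥2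
  ... | u , v , u≢v , tu , tv = u , v , u≢v , cong encode (same-triple⇒same-path D₀≢C₀ (ᵇ⇒triple tu) (ᵇ⇒triple tv))

  -- Since Γ is not a multicover, some w ∈ B(u₀) lies outside Γ(D₀), hence
  -- outside the part of u₀: the refinement is proper.
  part-proper : ∃ λ u → ∃ λ v → f u ≡ f v × part u ≢ part v
  part-proper with count-differ (λ u → (f u == f u₀) ∧ inN u D₀) (λ u → f u == f u₀)
                                (not-multicover (f u₀) D₀ (sees⇒qadj u₀-sees-D₀))
  ... | w , differs with ∧-differs differs
  ...   | same , unseen = u₀ , w , sym (==⇒≡ same) ,
      (λ e → unseen (proj₁ (fibre⇒triple (pathOf-rep u₀) (encode-injective {pathOf w} {pathOf u₀} (sym e)))))

  quotient-iso : Iso (λ i j → T (Quot.qadj (Graph.adj Γ) part i j)) gadj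
  quotient-iso = decode , encode , encode-decode , decode-encode , (λ i j → forward i j , backward i j)
    where
    module Q = QuotientFacts (Graph.adj Γ) part
    forward : ∀ i j → T (Quot.qadj (Graph.adj Γ) part i j) → gadj (decode i) (decode j)
    forward i j t with Q.qadj-elim t
    ... | _ , u , w , refl , refl , e = subst₂ gadj (sym (decode-encode _)) (sym (decode-encode _)) (gimel-edge e)
    backward : ∀ i j → gadj (decode i) (decode j) → T (Quot.qadj (Graph.adj Γ) part i j)
    backward i j g with gimel-edge⁻ g
    ... | v , w , ev , ew , e = Q.qadj-intro (on-part ev) (on-part ew) e
          (λ i≡j → blocks-independent e (same-path⇒same-block (trans ev (trans (cong decode i≡j) (sym ew)))))
      where
      on-part : ∀ {u k} → pathOf u ≡ decode k → part u ≡ k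
      on-part {k = k} e' = trans (cong encode e') (encode-decode k)

  part-of-path : ∀ D B C → IsPath2 D B C →
    ∃ λ j → ∀ u → (part u ≡ j → InTriple u D B C) × (InTriple u D B C → part u ≡ j)
  part-of-path D B C (t₁ , t₂ , D≢C) with path D B C t₁ t₂ D≢C
  ... | p , r = encode p , part-is-triple {p} r

  path-of-part : ∀ j → ∃ λ D → ∃ λ B → ∃ λ C → IsPath2 D B C ×
    (∀ u → (part u ≡ j → InTriple u D B C) × (InTriple u D B C → part u ≡ j))
  path-of-part j = first p , middle p , last p , path-edges p , λ u →
      (λ e → proj₁ (part-is-triple {p} (rep-self p) u) (trans e (sym (encode-decode j)))) ,
      (λ t → trans (proj₂ (part-is-triple {p} (rep-self p) u) t) (encode-decode j))
    where
    p : Path2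
    p = decode j

lemma2p2 : ∀ {c ℓ : Level} (n m : ℕ) (Γ : Graph n) (X : Group c ℓ) (A : Action X n)
    (blk : Fin n → Fin m) (B₀ : Fin m) →
    -- Γ is X-symmetric
    Act.Symmetric A (Graph.adj Γ) →
    -- blk defines an X-invariant partition with 1 < |B| < |V(Γ)| (parts = nonempty fibres)
    (∀ B → ∃ λ u → blk u ≡ B) →
    Act.Invariant A blk →
    (∀ B → 1 < Quot.size (Graph.adj Γ) blk B × Quot.size (Graph.adj Γ) blk B < n) →
    -- Γ is not a multicover of Γ_B  (k ≠ v)
    (∀ B C → T (Quot.qadj (Graph.adj Γ) blk B C) →
       Quot.kSize (Graph.adj Γ) blk B C ≢ Quot.size (Graph.adj Γ) blk B) →
    -- b = val(Γ_B) ≥ 3 (hence ≥ 2)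
    (∀ B → 3 ≤ Quot.valQ (Graph.adj Γ) blk B) →
    -- r = 2
    (∀ v → Quot.rSize (Graph.adj Γ) blk v ≡ 2) →
    -- Γ(D) ∩ B₀ ∩ Γ(C) ≠ ∅ for every 2-path [D,B₀,C] of Γ_B
    (∀ D C → Quot.IsPath2 (Graph.adj Γ) blk D B₀ C →
       ∃ λ u → T (Quot.inN (Graph.adj Γ) blk u D) × blk u ≡ B₀ ×
               T (Quot.inN (Graph.adj Γ) blk u C)) →
    -- conclusions
    Act.TwoArcTransQ A (Graph.adj Γ) blk ×
    Act.SelfPairedOrbit3 A (Graph.adj Γ) blk (DeltaDef.Δ (Graph.adj Γ) blk) ×
    (∃ λ (λ' : ℕ) →
      (∀ D B C → Quot.IsPath2 (Graph.adj Γ) blk D B C →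
         Quot.lamSize (Graph.adj Γ) blk D B C ≡ λ') ×
      ( -- (a)
        (λ' ≡ 1 ×
         Iso (λ u v → T (Graph.adj Γ u v))
             (Gimel.gadj (Quot.qadj (Graph.adj Γ) blk) (DeltaDef.Δ (Graph.adj Γ) blk)))
      ⊎ -- (b)
        (2 ≤ λ' ×
         Σ ℕ λ p → Σ (Fin n → Fin p) λ q →
           -- the parts of q are exactly the sets Γ(D) ∩ B ∩ Γ(C), [D,B,C] a 2-path
           (∀ j → ∃ λ u → q u ≡ j) ×
           (∀ D B C → Quot.IsPath2 (Graph.adj Γ) blk D B C →
              ∃ λ j → ∀ u → (q u ≡ j →
                   T (Quot.inN (Graph.adj Γ) blk u D) × blk u ≡ B ×
                   T (Quot.inN (Graph.adj Γ) blk u C)) ×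
                (T (Quot.inN (Graph.adj Γ) blk u D) × blk u ≡ B ×
                   T (Quot.inN (Graph.adj Γ) blk u C) → q u ≡ j)) ×
           (∀ j → ∃ λ D → ∃ λ B → ∃ λ C → Quot.IsPath2 (Graph.adj Γ) blk D B C ×
              (∀ u → (q u ≡ j →
                   T (Quot.inN (Graph.adj Γ) blk u D) × blk u ≡ B ×
                   T (Quot.inN (Graph.adj Γ) blk u C)) ×
                (T (Quot.inN (Graph.adj Γ) blk u D) × blk u ≡ B ×
                   T (Quot.inN (Graph.adj Γ) blk u C) → q u ≡ j))) ×
           -- nontrivial
           (∃ λ u → ∃ λ v → u ≢ v × q u ≡ q v) ×
           (∃ λ u → ∃ λ v → q u ≢ q v) ×
           -- X-invariant
           Act.Invariant A q ×
           -- proper refinement of B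
           (∀ u v → q u ≡ q v → blk u ≡ blk v) ×
           (∃ λ u → ∃ λ v → blk u ≡ blk v × q u ≢ q v) ×
           -- Γ_Q ≅ ℷ(Γ_B, Δ)
           Iso (λ i j → T (Quot.qadj (Graph.adj Γ) q i j))
               (Gimel.gadj (Quot.qadj (Graph.adj Γ) blk) (DeltaDef.Δ (Graph.adj Γ) blk)))))
lemma2p2 n m Γ X A blk B₀ symmetric surj inv _ not-multicover valency r≡2 nonempty-at-B₀ =
  two-arc-transitive , Δ-self-paired-orbit , λ₀ , λ-constant ,
  (case m≤n⇒m<n∨m≡n λ-positive of λ
    { (inj₂ 1≡λ) → inj₁ (sym 1≡λ , case-λ≡1 (sym 1≡λ))
    ; (inj₁ λ≥2) → inj₂ (λ≥2 , _ , part , parts-nonempty , part-of-path , path-of-part ,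
                         part-nontrivial λ≥2 , different-parts , part-invariant , part-refines ,
                         part-proper , quotient-iso) })
  where
  open Setting Γ A blk B₀ symmetric surj inv not-multicover valency r≡2 nonempty-at-B₀
  different-parts : ∃ λ u → ∃ λ v → part u ≢ part v
  different-parts = let (u , v , _ , u≢v) = part-proper in u , v , u≢v
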